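{- Let $\ell_1,\dots,\ell_t$ be positive integers, $\kappa_1,\dots,\kappa_t$ positive reals, and $\mathcal L=\max_i\ell_i$. Every composition tree with $n$ vertices has a subtree whose number of vertices lies in the interval \[ \left[\frac{n-1}{\mathcal L+1},\ \frac{\mathcal L n+1}{\mathcal L+1}\right]. \]
   Context: A composition tree is a rooted tree in which each vertex is assigned one of the values $\kappa_1,\dots,\kappa_t$ and, if a vertex is assigned $\kappa_i$, the vertex has exactly $\ell_i$ ordered branches, each of which is either empty or a composition tree (so even a leaf has a specified number of branches, all empty). A subtree means the subtree consisting of some vertex together with all of its descendants. -}

module Defs where

open import Data.Nat using (ℕ; zero; suc; _+_; _⊔_)
open import Data.Fin using (Fin; zero; suc)
open import Data.Maybe using (Maybe; just; nothing)
open import Data.Vec using (Vec; []; _∷_)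

-- A vertex carries a type i : Fin t (standing for the value κ_i) and
-- exactly ℓ i ordered branches, each empty (nothing) or a composition tree.
data CTree (t : ℕ) (ℓ : Fin t → ℕ) : Set where
  node : (i : Fin t) → Vec (Maybe (CTree t ℓ)) (ℓ i) → CTree t ℓ

module _ {t : ℕ} {ℓ : Fin t → ℕ} where
  mutual
    size : CTree t ℓ → ℕ
    size (node i bs) = suc (sizeBranches bs)

    sizeBranches : ∀ {k} → Vec (Maybe (CTree t ℓ)) k → ℕ
    sizeBranches [] = 0
    sizeBranches (nothing ∷ bs) = sizeBranches bs
    sizeBranches (just c ∷ bs) = size c + sizeBranches bs

  mutual
    -- S ⊑ T : S is the subtree of T rooted at some vertex of T
    -- (a vertex together with all its descendants).
    data _⊑_ (S : CTree t ℓ) : CTree t ℓ → Set where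
      here  : S ⊑ S
      there : ∀ {i} {bs : Vec (Maybe (CTree t ℓ)) (ℓ i)} →
              InBranches S bs → S ⊑ node i bs

    data InBranches (S : CTree t ℓ) : ∀ {k} → Vec (Maybe (CTree t ℓ)) k → Set where
      inHead : ∀ {k} {c : CTree t ℓ} {bs : Vec (Maybe (CTree t ℓ)) k} →
               S ⊑ c → InBranches S (just c ∷ bs)
      inTail : ∀ {k} {b : Maybe (CTree t ℓ)} {bs : Vec (Maybe (CTree t ℓ)) k} →
               InBranches S bs → InBranches S (b ∷ bs)

maxArity : ∀ {t} → (Fin t → ℕ) → ℕ
maxArity {zero} ℓ = 0
maxArity {suc t} ℓ = ℓ zero ⊔ maxArity (λ i → ℓ (suc i))

{-# OPTIONS --safe #-}
-- Walk down from the root, always moving into a largest branch. A vertex U has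
-- at most 𝓛 branches, so its largest branch has at least (|U| - 1)/𝓛 vertices.
-- Hence, while (𝓛 + 1)|U| still exceeds 𝓛n + 1, the largest branch keeps at
-- least (n - 1)/(𝓛 + 1) vertices, and the walk must stop at a subtree that
-- satisfies both bounds.
module Submission where

open import Defs
open import Data.Nat using (ℕ; suc; _+_; _*_; _∸_; _≤_; _<_; _≤?_; z≤n; s≤s)
open import Data.Nat.Properties
open import Data.Nat.Induction using (<-wellFounded)
open import Data.Nat.Solver using (module +-*-Solver)
open import Data.Fin using (Fin; zero; suc)
open import Data.Maybe using (Maybe; just; nothing)
open import Data.Vec using (Vec; []; _∷_)
open import Data.Product using (Σ; _×_; _,_)
open import Data.Sum using (_⊎_; inj₁; inj₂)
open import Induction.WellFounded using (Acc; acc)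
open import Relation.Nullary using (yes; no)
open import Relation.Nullary.Negation using (contradiction)
open import Relation.Binary.PropositionalEquality using (_≡_; refl; sym; cong; subst; subst₂)

ℓ≤maxArity : ∀ {t} (ℓ : Fin t → ℕ) (i : Fin t) → ℓ i ≤ maxArity ℓ
ℓ≤maxArity {suc t} ℓ zero    = m≤m⊔n (ℓ zero) _
ℓ≤maxArity {suc t} ℓ (suc i) =
  ≤-trans (ℓ≤maxArity (λ j → ℓ (suc j)) i) (m≤n⊔m (ℓ zero) _)

[1+L]*1≤L*[1+n]+1 : ∀ L n → suc L * 1 ≤ L * suc n + 1
[1+L]*1≤L*[1+n]+1 L n = begin
  suc L * 1     ≡⟨ *-identityʳ (suc L) ⟩
  suc L         ≡⟨ +-comm 1 L ⟩
  L + 1         ≡⟨ cong (_+ 1) (*-identityʳ L) ⟨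
  L * 1 + 1     ≤⟨ +-monoˡ-≤ 1 (*-monoʳ-≤ L (s≤s z≤n)) ⟩
  L * suc n + 1 ∎
  where open ≤-Reasoning

lowerBound-descends : ∀ L n b c → b ≤ L * c → L * suc n + 1 < suc L * suc b →
                      n ≤ suc L * c
lowerBound-descends L n b c b≤Lc too-big =
  <⇒≤ (*-cancelˡ-< L n (suc L * c) (begin-strict
    L * n               <⟨ +-cancelˡ-< (suc L) (L * n) (suc L * b)
                             (subst₂ _<_ (lhs≡ L n) (*-suc (suc L) b) too-big) ⟩
    suc L * b           ≤⟨ *-monoʳ-≤ (suc L) b≤Lc ⟩
    suc L * (L * c)     ≡⟨ swap≡ L c ⟩
    L * (suc L * c)     ∎))
  where
  open ≤-Reasoning
  open +-*-Solver
  lhs≡ : ∀ L n → L * suc n + 1 ≡ suc L + L * n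
  lhs≡ = solve 2 (λ L n → L :* (con 1 :+ n) :+ con 1 := (con 1 :+ L) :+ L :* n) refl
  swap≡ : ∀ L c → suc L * (L * c) ≡ L * (suc L * c)
  swap≡ = solve 2 (λ L c → (con 1 :+ L) :* (L :* c) := L :* ((con 1 :+ L) :* c)) refl

module _ {t : ℕ} {ℓ : Fin t → ℕ} where

  Branches : ℕ → Set
  Branches = Vec (Maybe (CTree t ℓ))

  mutual
    ⊑-trans : {S U V : CTree t ℓ} → S ⊑ U → U ⊑ V → S ⊑ V
    ⊑-trans S⊑U here      = S⊑U
    ⊑-trans S⊑U (there p) = there (⊑-InBranches S⊑U p)

    ⊑-InBranches : ∀ {k} {S U : CTree t ℓ} {bs : Branches k} →
                   S ⊑ U → InBranches U bs → InBranches S bs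
    ⊑-InBranches S⊑U (inHead p) = inHead (⊑-trans S⊑U p)
    ⊑-InBranches S⊑U (inTail p) = inTail (⊑-InBranches S⊑U p)

  mutual
    size-⊑ : {S U : CTree t ℓ} → S ⊑ U → size S ≤ size U
    size-⊑ here      = ≤-refl
    size-⊑ (there p) = m≤n⇒m≤1+n (size-InBranches p)

    size-InBranches : ∀ {k} {S : CTree t ℓ} {bs : Branches k} →
                      InBranches S bs → size S ≤ sizeBranches bs
    size-InBranches {bs = just c ∷ _} (inHead p) = ≤-trans (size-⊑ p) (m≤m+n _ _)
    size-InBranches {bs = nothing ∷ _} (inTail p) = size-InBranches p
    size-InBranches {bs = just c ∷ _} (inTail p) =
      ≤-trans (size-InBranches p) (m≤n+m _ (size c))

  record LargestBranch {k} (bs : Branches k) : Set where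
    constructor largest
    field
      branch        : CTree t ℓ
      inBranches    : InBranches branch bs
      sizeBranches≤ : sizeBranches bs ≤ k * size branch

  largestBranch : ∀ {k} (bs : Branches k) → sizeBranches bs ≡ 0 ⊎ LargestBranch bs
  largestBranch [] = inj₁ refl
  largestBranch {suc k} (nothing ∷ bs) with largestBranch bs
  ... | inj₁ empty = inj₁ empty
  ... | inj₂ (largest c c∈ ≤k*c) = inj₂ (largest c (inTail c∈) (≤-trans ≤k*c (m≤n+m _ (size c))))
  largestBranch {suc k} (just d ∷ bs) with largestBranch bs
  ... | inj₁ empty = inj₂ (largest d (inHead here)
                        (+-monoʳ-≤ (size d) (≤-trans (≤-reflexive empty) z≤n)))
  ... | inj₂ (largest c c∈ ≤k*c) with size c ≤? size d
  ...   | yes c≤d = inj₂ (largest d (inHead here)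
                      (+-monoʳ-≤ (size d) (≤-trans ≤k*c (*-monoʳ-≤ k c≤d))))
  ...   | no  c≰d = inj₂ (largest c (inTail c∈)
                      (+-mono-≤ (<⇒≤ (≰⇒> c≰d)) ≤k*c))

  -- m stands for n - 1, the size of the whole tree minus its root.
  module Descent (L m : ℕ) (ℓ≤L : ∀ i → ℓ i ≤ L) where

    Balanced : CTree t ℓ → Set
    Balanced S = m ≤ suc L * size S × suc L * size S ≤ L * suc m + 1

    descend : (U : CTree t ℓ) → Acc _<_ (size U) → m ≤ suc L * size U →
              Σ (CTree t ℓ) λ S → S ⊑ U × Balanced S
    descend U _ lower with suc L * size U ≤? L * suc m + 1
    ... | yes upper = U , here , lower , upper
    descend (node i bs) (acc rec) lower | no too-big with largestBranch bs
    ... | inj₁ empty = contradiction (subst (λ b → suc L * suc b ≤ L * suc m + 1)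
                         (sym empty) ([1+L]*1≤L*[1+n]+1 L m)) too-big
    ... | inj₂ (largest c c∈ ≤k*c) with descend c (rec (s≤s (size-InBranches c∈)))
                (lowerBound-descends L m _ (size c)
                  (≤-trans ≤k*c (*-monoˡ-≤ (size c) (ℓ≤L i))) (≰⇒> too-big))
    ...   | S , S⊑c , balanced = S , there (⊑-InBranches S⊑c c∈) , balanced

lemma1 : (t : ℕ) (ℓ : Fin t → ℕ) → (∀ i → 1 ≤ ℓ i) →
         (T : CTree t ℓ) →
         Σ (CTree t ℓ) λ S → S ⊑ T ×
           (size T ∸ 1 ≤ suc (maxArity ℓ) * size S ×
            suc (maxArity ℓ) * size S ≤ maxArity ℓ * size T + 1)
lemma1 t ℓ _ T@(node _ bs) =
  descend T (<-wellFounded (size T)) (≤-trans (n≤1+n _) (m≤n*m (size T) (suc L)))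
  where
  L = maxArity ℓ
  open Descent L (sizeBranches bs) (ℓ≤maxArity ℓ)
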